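{- Let $a\leqslant b$ be two positive integers. Let $G=(X,Y)$ be a bipartite graph with parts $X,Y$, $|X|\leqslant |Y|$, containing no $[a,b]$-factor. (i) If $a|Y|>b|X|$, then $e(G)\leqslant |X||Y|$ with equality if and only if $G\cong K_{|X|,|Y|}$. (ii) If $a|Y|\leqslant b|X|$ and $a>|X|$, then $e(G)\leqslant |X||Y|$ with equality if and only if $G\cong K_{|X|,|Y|}$. (iii) If $a|Y|\leqslant b|X|$ and $a\leqslant |X|$, then $e(G)\leqslant |X|(|Y|-1)+a-1$ with equality if and only if $G\cong D(a-1,|X|-a+1;|Y|-1,1)$.
   Context: For positive integers $a\leqslant b$, an $[a,b]$-factor of a graph $G$ is a spanning subgraph $F$ with $a\leqslant d_F(v)\leqslant b$ for all $v$. For nonnegative integers $p_1,p_2,q_1,q_2$, $D(p_1,p_2;q_1,q_2)$ denotes the bipartite graph with parts $X=X_1\cup X_2$, $Y=Y_1\cup Y_2$ (disjoint), $|X_i|=p_i$, $|Y_i|=q_i$, in which every vertex of $X_1$ is adjacent to every vertex of $Y_1\cup Y_2$, every vertex of $X_2$ is adjacent to every vertex of $Y_1$, and there are no other edges (a double nested graph). -}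

module Defs where

open import Data.Nat using (ℕ; zero; suc; _+_; _≤_; _<ᵇ_)
open import Data.Bool using (Bool; true; false; _∨_; if_then_else_)
open import Data.Fin using (Fin; toℕ) renaming (zero to fzero; suc to fsuc)
open import Data.Sum using (_⊎_; inj₁; inj₂)
open import Data.Product using (Σ; _×_)
open import Function.Bundles using (_↔_; Inverse)
open import Relation.Binary.PropositionalEquality using (_≡_)

count : ∀ {k} → (Fin k → Bool) → ℕ
count {zero}  f = 0
count {suc k} f = (if f fzero then 1 else 0) + count {k} (λ i → f (fsuc i))

sumFin : ∀ {k} → (Fin k → ℕ) → ℕ
sumFin {zero}  f = 0
sumFin {suc k} f = f fzero + sumFin {k} (λ i → f (fsuc i))

record BipGraph : Set where
  constructor bip
  field
    m : ℕ
    n : ℕ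
    E : Fin m → Fin n → Bool
open BipGraph public

edges : BipGraph → ℕ
edges G = sumFin {m G} (λ x → count {n G} (λ y → E G x y))

degX : ∀ {m n} → (Fin m → Fin n → Bool) → Fin m → ℕ
degX F x = count (λ y → F x y)

degY : ∀ {m n} → (Fin m → Fin n → Bool) → Fin n → ℕ
degY F y = count (λ x → F x y)

IsFactor : ℕ → ℕ → (G : BipGraph) → (Fin (m G) → Fin (n G) → Bool) → Set
IsFactor a b G F =
  ((x : Fin (m G)) (y : Fin (n G)) → F x y ≡ true → E G x y ≡ true)
  × ((x : Fin (m G)) → (a ≤ degX F x) × (degX F x ≤ b))
  × ((y : Fin (n G)) → (a ≤ degY F y) × (degY F y ≤ b))

HasFactor : ℕ → ℕ → BipGraph → Set
HasFactor a b G = Σ (Fin (m G) → Fin (n G) → Bool) (IsFactor a b G)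

V : BipGraph → Set
V G = Fin (m G) ⊎ Fin (n G)

adj : (G : BipGraph) → V G → V G → Bool
adj G (inj₁ x) (inj₂ y) = E G x y
adj G (inj₂ y) (inj₁ x) = E G x y
adj G (inj₁ _) (inj₁ _) = false
adj G (inj₂ _) (inj₂ _) = false

-- Graph isomorphism: a bijection of vertex sets preserving adjacency
-- (not required to respect the bipartition sides).
_≅_ : BipGraph → BipGraph → Set
G ≅ H = Σ (V G ↔ V H) λ σ →
  (u v : V G) → adj G u v ≡ adj H (Inverse.to σ u) (Inverse.to σ v)

K : ℕ → ℕ → BipGraph
K p q = bip p q (λ _ _ → true)

-- Double nested graph D(p1,p2;q1,q2): X1 = first p1 vertices of X, Y1 = first q1 of Y;
-- x ~ y iff x ∈ X1 or y ∈ Y1.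
D : ℕ → ℕ → ℕ → ℕ → BipGraph
D p₁ p₂ q₁ q₂ = bip (p₁ + p₂) (q₁ + q₂) (λ x y → (toℕ x <ᵇ p₁) ∨ (toℕ y <ᵇ q₁))

{-# OPTIONS --safe #-}

-- Parts (i) and (ii) hold for every bipartite graph: e(G) ≤ |X||Y|, with equality exactly
-- for K_{|X|,|Y|}. For (iii) let M = |X|, n = |Y| and let k be the number of non-edges.
-- If k + a ≤ M there is an [a,b]-factor: order the columns so that the first r = n − M of
-- them are complete and give the j-th one the cyclic interval of a rows starting at e + j a;
-- these intervals deal the rows out round-robin, so every row lies in at most ⌈r a / M⌉ ≤ b − a
-- of them (this is where a n ≤ b M enters). On the remaining M × M square join row x to
-- column i iff (i + σ x) mod M lies in a set T of a residues avoiding the at most k residues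
-- hit by non-edges. Hence k ≥ M − a + 1, which is the bound. At equality the construction
-- still works if two non-edges lie in different rows and columns (a transposition σ of the
-- rows makes them hit the same residue), or if all non-edges lie in one row and M < n (one of
-- them moves into the first interval, which starts just after its row). So the non-edges form
-- a column, or a row with M = n, and G ≅ D(a−1, M−a+1; n−1, 1).

module Submission where

open import Defs
open import Data.Nat using (ℕ; zero; suc; _+_; _*_; _∸_; _≤_; _<_; z≤n; s≤s; s≤s⁻¹; z<s; _<ᵇ_)
open import Data.Nat.Properties
open import Data.Nat.DivMod using (_%_; _mod_; [m+kn]%n≡m%n; %-distribˡ-+; m%n%n≡m%n; m<n⇒m%n≡m; m%n<n)
open import Data.Nat.Solver using (module +-*-Solver)
open +-*-Solver using (solve; _:+_; _:*_; _:=_; con)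
import Algebra.Properties.CommutativeMonoid.Sum +-0-commutativeMonoid as ℕ-Sum
open import Data.Bool using (Bool; true; false; not; _∧_; _∨_; if_then_else_)
open import Data.Bool.Properties using (T-≡; not-injective; ∨-identityʳ; ∨-zeroʳ) renaming (_≟_ to _≟ᴮ_)
open import Data.Fin using (Fin; toℕ; fromℕ<; splitAt; punchIn; cast; _↑ˡ_) renaming (zero to fzero; suc to fsuc)
open import Data.Fin.Properties
  using (any?; +↔⊎; splitAt-join; toℕ-injective; toℕ-fromℕ<; toℕ<n; toℕ-cast; toℕ-↑ˡ)
  renaming (_≟_ to _≟ᶠ_; suc-injective to fsuc-injective)
open import Data.Fin.Permutation
  using (Permutation; Permutation′; permutation; id; insert; flip; ↔⇒≡; cast-id; transpose; _∘ₚ_;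
         _⟨$⟩ʳ_; _⟨$⟩ˡ_; inverseˡ; inverseʳ)
import Data.Fin.Permutation.Components as PC
open import Data.Sum using (_⊎_; inj₁; inj₂)
import Data.Sum as Sum
open import Data.Sum.Properties using (inj₁-injective)
open import Data.Sum.Algebra using (⊎-comm)
open import Data.Sum.Function.Propositional using (_⊎-↔_)
open import Data.Product using (Σ; _×_; _,_; proj₁; proj₂)
open import Function using (_∘_)
open import Function.Bundles using (_↔_; Inverse; Equivalence; _⇔_; mk⇔)
open import Function.Construct.Identity using (↔-id)
open import Function.Construct.Composition using (_↔-∘_)
open import Function.Construct.Symmetry using (↔-sym)
open import Relation.Binary.PropositionalEquality
open import Relation.Nullary using (¬_; ¬?; contradiction; does; yes; no; _×-dec_)
open import Relation.Nullary.Decidable using (dec-true)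

𝟙 : Bool → ℕ
𝟙 b = if b then 1 else 0

𝟙≤1 : ∀ b → 𝟙 b ≤ 1
𝟙≤1 true  = ≤-refl
𝟙≤1 false = z≤n

𝟙[0<ᵇ]≤ : ∀ v → 𝟙 (0 <ᵇ v) ≤ v
𝟙[0<ᵇ]≤ zero    = z≤n
𝟙[0<ᵇ]≤ (suc v) = s≤s z≤n

<ᵇ-true : ∀ {m n} → m < n → (m <ᵇ n) ≡ true
<ᵇ-true m<n = Equivalence.to T-≡ (<⇒<ᵇ m<n)

<ᵇ-true⁻¹ : ∀ {m n} → (m <ᵇ n) ≡ true → m < n
<ᵇ-true⁻¹ {m} {n} m<ᵇn = <ᵇ⇒< m n (Equivalence.from T-≡ m<ᵇn)

<ᵇ-false : ∀ {m n} → n ≤ m → (m <ᵇ n) ≡ false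
<ᵇ-false {m} {n} n≤m with m <ᵇ n in m<ᵇn
... | false = refl
... | true  = contradiction (<ᵇ-true⁻¹ m<ᵇn) (≤⇒≯ n≤m)

n<ᵇn : ∀ n → (n <ᵇ n) ≡ false
n<ᵇn zero    = refl
n<ᵇn (suc n) = n<ᵇn n

sumFin-cong : ∀ {k} {f g : Fin k → ℕ} → (∀ i → f i ≡ g i) → sumFin f ≡ sumFin g
sumFin-cong {zero}  f≗g = refl
sumFin-cong {suc k} f≗g = cong₂ _+_ (f≗g fzero) (sumFin-cong (λ i → f≗g (fsuc i)))

sumFin-mono-≤ : ∀ {k} {f g : Fin k → ℕ} → (∀ i → f i ≤ g i) → sumFin f ≤ sumFin g
sumFin-mono-≤ {zero}  f≤g = z≤n
sumFin-mono-≤ {suc k} f≤g = +-mono-≤ (f≤g fzero) (sumFin-mono-≤ (λ i → f≤g (fsuc i)))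

sumFin-mono-< : ∀ {k} {f g : Fin k → ℕ} → (∀ i → f i ≤ g i) → ∀ i → f i < g i → sumFin f < sumFin g
sumFin-mono-< f≤g fzero    fi<gi = +-mono-<-≤ fi<gi (sumFin-mono-≤ (λ i → f≤g (fsuc i)))
sumFin-mono-< f≤g (fsuc i) fi<gi = +-mono-≤-< (f≤g fzero) (sumFin-mono-< (λ j → f≤g (fsuc j)) i fi<gi)

sumFin-const : ∀ {k} c → sumFin {k} (λ _ → c) ≡ k * c
sumFin-const {zero}  c = refl
sumFin-const {suc k} c = cong (c +_) (sumFin-const {k} c)

sumFin-zero : ∀ {k} {f : Fin k → ℕ} → (∀ i → f i ≡ 0) → sumFin f ≡ 0
sumFin-zero {k} f≗0 = trans (sumFin-cong f≗0) (trans (sumFin-const {k} 0) (*-zeroʳ k))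

≤-sumFin : ∀ {k} (f : Fin k → ℕ) i → f i ≤ sumFin f
≤-sumFin f fzero    = m≤m+n _ _
≤-sumFin f (fsuc i) = ≤-trans (≤-sumFin (λ j → f (fsuc j)) i) (m≤n+m _ _)

+-≤-sumFin : ∀ {k} (f : Fin k → ℕ) {i j} → i ≢ j → f i + f j ≤ sumFin f
+-≤-sumFin f {fzero}  {fzero}  i≢j = contradiction refl i≢j
+-≤-sumFin f {fzero}  {fsuc j} i≢j = +-monoʳ-≤ (f fzero) (≤-sumFin (λ t → f (fsuc t)) j)
+-≤-sumFin f {fsuc i} {fzero}  i≢j =
  ≤-trans (≤-reflexive (+-comm (f (fsuc i)) (f fzero))) (+-monoʳ-≤ (f fzero) (≤-sumFin (λ t → f (fsuc t)) i))
+-≤-sumFin f {fsuc i} {fsuc j} i≢j =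
  ≤-trans (+-≤-sumFin (λ t → f (fsuc t)) (i≢j ∘ cong fsuc)) (m≤n+m _ _)

sumFin>0 : ∀ {k} (f : Fin k → ℕ) → 0 < sumFin f → Σ (Fin k) λ i → 0 < f i
sumFin>0 {suc k} f 0<sum with f fzero in f0
... | suc _ = fzero , subst (0 <_) (sym f0) z<s
... | zero  with sumFin>0 (λ i → f (fsuc i)) 0<sum
...   | i , 0<fi = fsuc i , 0<fi

sumFin-single : ∀ {k} (f : Fin k → ℕ) i₀ → (∀ i → i ≢ i₀ → f i ≡ 0) → sumFin f ≡ f i₀
sumFin-single f fzero     others =
  trans (cong (f fzero +_) (sumFin-zero (λ i → others (fsuc i) λ ()))) (+-identityʳ (f fzero))
sumFin-single f (fsuc i₀) others =
  trans (cong (_+ sumFin (λ i → f (fsuc i))) (others fzero λ ()))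
        (sumFin-single (λ i → f (fsuc i)) i₀ (λ i i≢i₀ → others (fsuc i) (i≢i₀ ∘ fsuc-injective)))

sumFin≡sum : ∀ {k} (f : Fin k → ℕ) → sumFin f ≡ ℕ-Sum.sum f
sumFin≡sum {zero}  f = refl
sumFin≡sum {suc k} f = cong (f fzero +_) (sumFin≡sum (λ i → f (fsuc i)))

sumFin-permute : ∀ {k l} (f : Fin l → ℕ) (π : Permutation k l) → sumFin f ≡ sumFin (λ i → f (π ⟨$⟩ʳ i))
sumFin-permute f π = begin
  sumFin f                        ≡⟨ sumFin≡sum f ⟩
  ℕ-Sum.sum f                     ≡⟨ ℕ-Sum.sum-permute f π ⟩
  ℕ-Sum.sum (λ i → f (π ⟨$⟩ʳ i))  ≡⟨ sumFin≡sum (λ i → f (π ⟨$⟩ʳ i)) ⟨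
  sumFin (λ i → f (π ⟨$⟩ʳ i))     ∎
  where open ≡-Reasoning

sumFin-distrib-+ : ∀ {k} (f g : Fin k → ℕ) → sumFin (λ i → f i + g i) ≡ sumFin f + sumFin g
sumFin-distrib-+ f g = begin
  sumFin (λ i → f i + g i)      ≡⟨ sumFin≡sum (λ i → f i + g i) ⟩
  ℕ-Sum.sum (λ i → f i + g i)   ≡⟨ ℕ-Sum.∑-distrib-+ f g ⟩
  ℕ-Sum.sum f + ℕ-Sum.sum g     ≡⟨ cong₂ _+_ (sumFin≡sum f) (sumFin≡sum g) ⟨
  sumFin f + sumFin g           ∎
  where open ≡-Reasoning

sumFin-comm : ∀ {k l} (f : Fin k → Fin l → ℕ) →
  sumFin (λ i → sumFin (λ j → f i j)) ≡ sumFin (λ j → sumFin (λ i → f i j))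
sumFin-comm f = begin
  sumFin (λ i → sumFin (f i))                          ≡⟨ sumFin≡sum (λ i → sumFin (f i)) ⟩
  ℕ-Sum.sum (λ i → sumFin (f i))                       ≡⟨ ℕ-Sum.sum-cong-≗ (λ i → sumFin≡sum (f i)) ⟩
  ℕ-Sum.sum (λ i → ℕ-Sum.sum (f i))                    ≡⟨ ℕ-Sum.∑-comm f ⟩
  ℕ-Sum.sum (λ j → ℕ-Sum.sum (λ i → f i j))            ≡⟨ ℕ-Sum.sum-cong-≗ (λ j → sumFin≡sum (λ i → f i j)) ⟨
  ℕ-Sum.sum (λ j → sumFin (λ i → f i j))               ≡⟨ sumFin≡sum (λ j → sumFin (λ i → f i j)) ⟨
  sumFin (λ j → sumFin (λ i → f i j))                  ∎
  where open ≡-Reasoning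

sumFin-splitAt : ∀ r {s} (f : Fin r ⊎ Fin s → ℕ) →
  sumFin {r + s} (λ p → f (splitAt r p)) ≡ sumFin (λ j → f (inj₁ j)) + sumFin (λ i → f (inj₂ i))
sumFin-splitAt zero    f = refl
sumFin-splitAt (suc r) f =
  trans (cong (f (inj₁ fzero) +_) (sumFin-splitAt r (λ u → f (Sum.map₁ fsuc u)))) (sym (+-assoc (f (inj₁ fzero)) _ _))

sumFin-↔⊎ : ∀ {n r s} (θ : Fin n ↔ (Fin r ⊎ Fin s)) (f : Fin r ⊎ Fin s → ℕ) →
  sumFin (λ y → f (Inverse.to θ y)) ≡ sumFin (λ j → f (inj₁ j)) + sumFin (λ i → f (inj₂ i))
sumFin-↔⊎ {r = r} θ f = begin
  sumFin (λ y → f (Inverse.to θ y))                   ≡⟨ sumFin-cong (λ y → cong f (splitAt-join r _ (Inverse.to θ y))) ⟨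
  sumFin (λ y → f (splitAt r (π ⟨$⟩ʳ y)))              ≡⟨ sumFin-permute (λ p → f (splitAt r p)) π ⟨
  sumFin (λ p → f (splitAt r p))                      ≡⟨ sumFin-splitAt r f ⟩
  sumFin (λ j → f (inj₁ j)) + sumFin (λ i → f (inj₂ i)) ∎
  where
  open ≡-Reasoning
  π : Permutation _ (r + _)
  π = ↔-sym +↔⊎ ↔-∘ θ

count≡sum𝟙 : ∀ {k} (f : Fin k → Bool) → count f ≡ sumFin (λ i → 𝟙 (f i))
count≡sum𝟙 {zero}  f = refl
count≡sum𝟙 {suc k} f = cong (𝟙 (f fzero) +_) (count≡sum𝟙 (λ i → f (fsuc i)))

count-cong : ∀ {k} {f g : Fin k → Bool} → (∀ i → f i ≡ g i) → count f ≡ count g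
count-cong {f = f} {g} f≗g = begin
  count f                  ≡⟨ count≡sum𝟙 f ⟩
  sumFin (λ i → 𝟙 (f i))   ≡⟨ sumFin-cong (λ i → cong 𝟙 (f≗g i)) ⟩
  sumFin (λ i → 𝟙 (g i))   ≡⟨ count≡sum𝟙 g ⟨
  count g                  ∎
  where open ≡-Reasoning

count-permute : ∀ {k l} (f : Fin l → Bool) (π : Permutation k l) → count f ≡ count (λ i → f (π ⟨$⟩ʳ i))
count-permute f π = begin
  count f                                ≡⟨ count≡sum𝟙 f ⟩
  sumFin (λ i → 𝟙 (f i))                 ≡⟨ sumFin-permute (λ i → 𝟙 (f i)) π ⟩
  sumFin (λ i → 𝟙 (f (π ⟨$⟩ʳ i)))        ≡⟨ count≡sum𝟙 (λ i → f (π ⟨$⟩ʳ i)) ⟨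
  count (λ i → f (π ⟨$⟩ʳ i))             ∎
  where open ≡-Reasoning

count-↔⊎ : ∀ {n r s} (θ : Fin n ↔ (Fin r ⊎ Fin s)) (f : Fin r ⊎ Fin s → Bool) →
  count (λ y → f (Inverse.to θ y)) ≡ count (λ j → f (inj₁ j)) + count (λ i → f (inj₂ i))
count-↔⊎ θ f = begin
  count (λ y → f (Inverse.to θ y))                       ≡⟨ count≡sum𝟙 (λ y → f (Inverse.to θ y)) ⟩
  sumFin (λ y → 𝟙 (f (Inverse.to θ y)))                  ≡⟨ sumFin-↔⊎ θ (λ u → 𝟙 (f u)) ⟩
  sumFin (λ j → 𝟙 (f (inj₁ j))) + sumFin (λ i → 𝟙 (f (inj₂ i)))
    ≡⟨ cong₂ _+_ (count≡sum𝟙 (λ j → f (inj₁ j))) (count≡sum𝟙 (λ i → f (inj₂ i))) ⟨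
  count (λ j → f (inj₁ j)) + count (λ i → f (inj₂ i))    ∎
  where open ≡-Reasoning

count≤ : ∀ {k} (f : Fin k → Bool) → count f ≤ k
count≤ {k} f = begin
  count f                 ≡⟨ count≡sum𝟙 f ⟩
  sumFin (λ i → 𝟙 (f i))  ≤⟨ sumFin-mono-≤ (λ i → 𝟙≤1 (f i)) ⟩
  sumFin {k} (λ _ → 1)    ≡⟨ sumFin-const {k} 1 ⟩
  k * 1                   ≡⟨ *-identityʳ k ⟩
  k                       ∎
  where open ≤-Reasoning

count-compl : ∀ {k} (f : Fin k → Bool) → count f + count (λ i → not (f i)) ≡ k
count-compl {zero}  f = refl
count-compl {suc k} f with f fzero
... | true  = cong suc (count-compl (λ i → f (fsuc i)))
... | false = trans (+-suc _ _) (cong suc (count-compl (λ i → f (fsuc i))))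

count-all-false : ∀ {k} {f : Fin k → Bool} → (∀ i → f i ≡ false) → count f ≡ 0
count-all-false {zero}  f≡false = refl
count-all-false {suc k} f≡false rewrite f≡false fzero = count-all-false (λ i → f≡false (fsuc i))

count-all-true : ∀ {k} {f : Fin k → Bool} → (∀ i → f i ≡ true) → count f ≡ k
count-all-true {zero}  f≡true = refl
count-all-true {suc k} f≡true rewrite f≡true fzero = cong suc (count-all-true (λ i → f≡true (fsuc i)))

count>0 : ∀ {k} (f : Fin k → Bool) {i} → f i ≡ true → 0 < count f
count>0 f {i} fi = begin
  1                       ≡⟨ cong 𝟙 fi ⟨
  𝟙 (f i)                 ≤⟨ ≤-sumFin (λ j → 𝟙 (f j)) i ⟩
  sumFin (λ j → 𝟙 (f j))  ≡⟨ count≡sum𝟙 f ⟨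
  count f                 ∎
  where open ≤-Reasoning

count>1 : ∀ {k} (f : Fin k → Bool) {i j} → i ≢ j → f i ≡ true → f j ≡ true → 1 < count f
count>1 f {i} {j} i≢j fi fj = begin
  2                           ≡⟨ cong₂ _+_ (cong 𝟙 fi) (cong 𝟙 fj) ⟨
  𝟙 (f i) + 𝟙 (f j)           ≤⟨ +-≤-sumFin (λ t → 𝟙 (f t)) i≢j ⟩
  sumFin (λ t → 𝟙 (f t))      ≡⟨ count≡sum𝟙 f ⟨
  count f                     ∎
  where open ≤-Reasoning

count>0⁻¹ : ∀ {k} (f : Fin k → Bool) → 0 < count f → Σ (Fin k) λ i → f i ≡ true
count>0⁻¹ f 0<count with sumFin>0 (λ i → 𝟙 (f i)) (subst (0 <_) (count≡sum𝟙 f) 0<count)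
... | i , 0<𝟙fi = i , 𝟙>0⁻¹ (f i) 0<𝟙fi
  where
  𝟙>0⁻¹ : ∀ b → 0 < 𝟙 b → b ≡ true
  𝟙>0⁻¹ true _ = refl

count≡0⇒false : ∀ {k} (f : Fin k → Bool) → count f ≡ 0 → ∀ i → f i ≡ false
count≡0⇒false f count≡0 i with f i in fi
... | false = refl
... | true  = contradiction count≡0 (>⇒≢ (count>0 f fi))

count-<ᵇ : ∀ {k} c → c ≤ k → count {k} (λ i → toℕ i <ᵇ c) ≡ c
count-<ᵇ {k}     zero    _         = count-all-false {k} (λ _ → refl)
count-<ᵇ {suc k} (suc c) (s≤s c≤k) = cong suc (count-<ᵇ c c≤k)

count-≟ : ∀ {k} (w : Fin k) → count (λ i → does (i ≟ᶠ w)) ≡ 1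
count-≟ {suc k} fzero    = cong suc (count-all-false {k} (λ _ → refl))
count-≟ {suc k} (fsuc w) = trans (count-cong {g = λ i → does (i ≟ᶠ w)} (λ _ → refl)) (count-≟ w)

count-∧-≟ : ∀ {k} b (w : Fin k) → count (λ z → b ∧ does (z ≟ᶠ w)) ≡ 𝟙 b
count-∧-≟ {k} true  w = count-≟ w
count-∧-≟ {k} false w = count-all-false {k} (λ _ → refl)

count-nonzero≤sumFin : ∀ {k} (c : Fin k → ℕ) → count (λ i → 0 <ᵇ c i) ≤ sumFin c
count-nonzero≤sumFin c = begin
  count (λ i → 0 <ᵇ c i)        ≡⟨ count≡sum𝟙 (λ i → 0 <ᵇ c i) ⟩
  sumFin (λ i → 𝟙 (0 <ᵇ c i))   ≤⟨ sumFin-mono-≤ (λ i → 𝟙[0<ᵇ]≤ (c i)) ⟩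
  sumFin c                      ∎
  where open ≤-Reasoning

count-nonzero<sumFin : ∀ {k} (c : Fin k → ℕ) i → 1 < c i → count (λ i → 0 <ᵇ c i) < sumFin c
count-nonzero<sumFin c i 1<ci = begin-strict
  count (λ i → 0 <ᵇ c i)        ≡⟨ count≡sum𝟙 (λ i → 0 <ᵇ c i) ⟩
  sumFin (λ i → 𝟙 (0 <ᵇ c i))   <⟨ sumFin-mono-< (λ j → 𝟙[0<ᵇ]≤ (c j)) i (≤-<-trans (𝟙≤1 (0 <ᵇ c i)) 1<ci) ⟩
  sumFin c                      ∎
  where open ≤-Reasoning

sumFin-count-comm : ∀ {k l} (R : Fin k → Fin l → Bool) →
  sumFin (λ y → count (λ x → R x y)) ≡ sumFin (λ x → count (R x))
sumFin-count-comm R = begin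
  sumFin (λ y → count (λ x → R x y))           ≡⟨ sumFin-cong (λ y → count≡sum𝟙 (λ x → R x y)) ⟩
  sumFin (λ y → sumFin (λ x → 𝟙 (R x y)))      ≡⟨ sumFin-comm (λ y x → 𝟙 (R x y)) ⟩
  sumFin (λ x → sumFin (λ y → 𝟙 (R x y)))      ≡⟨ sumFin-cong (λ x → count≡sum𝟙 (R x)) ⟨
  sumFin (λ x → count (R x))                   ∎
  where open ≡-Reasoning

sumFin-fibres : ∀ {k l N} (A : Fin k → Fin l → Bool) (f : Fin k → Fin l → Fin N) →
  sumFin (λ z → sumFin (λ x → count (λ y → A x y ∧ does (z ≟ᶠ f x y)))) ≡ sumFin (λ x → count (A x))
sumFin-fibres A f = begin
  sumFin (λ z → sumFin (λ x → count (λ y → A x y ∧ does (z ≟ᶠ f x y))))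
    ≡⟨ sumFin-comm (λ z x → count (λ y → A x y ∧ does (z ≟ᶠ f x y))) ⟩
  sumFin (λ x → sumFin (λ z → count (λ y → A x y ∧ does (z ≟ᶠ f x y))))
    ≡⟨ sumFin-cong (λ x → sumFin-cong (λ z → count≡sum𝟙 (λ y → A x y ∧ does (z ≟ᶠ f x y)))) ⟩
  sumFin (λ x → sumFin (λ z → sumFin (λ y → 𝟙 (A x y ∧ does (z ≟ᶠ f x y)))))
    ≡⟨ sumFin-cong (λ x → sumFin-comm (λ z y → 𝟙 (A x y ∧ does (z ≟ᶠ f x y)))) ⟩
  sumFin (λ x → sumFin (λ y → sumFin (λ z → 𝟙 (A x y ∧ does (z ≟ᶠ f x y)))))
    ≡⟨ sumFin-cong (λ x → sumFin-cong (λ y → count≡sum𝟙 (λ z → A x y ∧ does (z ≟ᶠ f x y)))) ⟨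
  sumFin (λ x → sumFin (λ y → count (λ z → A x y ∧ does (z ≟ᶠ f x y))))
    ≡⟨ sumFin-cong (λ x → sumFin-cong (λ y → count-∧-≟ (A x y) (f x y))) ⟩
  sumFin (λ x → sumFin (λ y → 𝟙 (A x y)))
    ≡⟨ sumFin-cong (λ x → count≡sum𝟙 (A x)) ⟨
  sumFin (λ x → count (A x)) ∎
  where open ≡-Reasoning

takeTrue : ∀ {k} → ℕ → (Fin k → Bool) → Fin k → Bool
takeTrue zero    Q i        = false
takeTrue (suc a) Q fzero    = Q fzero
takeTrue (suc a) Q (fsuc i) = takeTrue (if Q fzero then a else suc a) (λ j → Q (fsuc j)) i

takeTrue-⊆ : ∀ {k} a (Q : Fin k → Bool) i → takeTrue a Q i ≡ true → Q i ≡ true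
takeTrue-⊆ zero    Q i        ()
takeTrue-⊆ (suc a) Q fzero    taken = taken
takeTrue-⊆ (suc a) Q (fsuc i) taken = takeTrue-⊆ (if Q fzero then a else suc a) (λ j → Q (fsuc j)) i taken

count-takeTrue : ∀ {k} a (Q : Fin k → Bool) → a ≤ count Q → count (takeTrue a Q) ≡ a
count-takeTrue {k}     zero    Q _ = count-all-false {k} (λ _ → refl)
count-takeTrue {suc k} (suc a) Q a<count with Q fzero
... | true  = cong suc (count-takeTrue a (λ j → Q (fsuc j)) (s≤s⁻¹ a<count))
... | false = count-takeTrue (suc a) (λ j → Q (fsuc j)) a<count

sumℕ : ℕ → (ℕ → ℕ) → ℕ
sumℕ zero    h = 0
sumℕ (suc N) h = h 0 + sumℕ N (λ t → h (suc t))

sumFin-toℕ : ∀ {N} (h : ℕ → ℕ) → sumFin {N} (λ i → h (toℕ i)) ≡ sumℕ N h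
sumFin-toℕ {zero}  h = refl
sumFin-toℕ {suc N} h = cong (h 0 +_) (sumFin-toℕ {N} (λ t → h (suc t)))

sumℕ-cong : ∀ N {g h : ℕ → ℕ} → (∀ t → g t ≡ h t) → sumℕ N g ≡ sumℕ N h
sumℕ-cong zero    g≗h = refl
sumℕ-cong (suc N) g≗h = cong₂ _+_ (g≗h 0) (sumℕ-cong N (λ t → g≗h (suc t)))

≤-sumℕ : ∀ N (h : ℕ → ℕ) {t} → t < N → h t ≤ sumℕ N h
≤-sumℕ (suc N) h {zero}  _         = m≤m+n _ _
≤-sumℕ (suc N) h {suc t} (s≤s t<N) = ≤-trans (≤-sumℕ N (λ u → h (suc u)) t<N) (m≤n+m _ _)

sumℕ-+ : ∀ p q (h : ℕ → ℕ) → sumℕ (p + q) h ≡ sumℕ p h + sumℕ q (λ t → h (p + t))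
sumℕ-+ zero    q h = refl
sumℕ-+ (suc p) q h = trans (cong (h 0 +_) (sumℕ-+ p q (λ t → h (suc t)))) (sym (+-assoc (h 0) _ _))

sumℕ-blocks : ∀ r a (g : ℕ → ℕ) → sumℕ r (λ j → sumℕ a (λ u → g (j * a + u))) ≡ sumℕ (r * a) g
sumℕ-blocks zero    a g = refl
sumℕ-blocks (suc r) a g = begin
  sumℕ a g + sumℕ r (λ j → sumℕ a (λ u → g (a + j * a + u)))
    ≡⟨ cong (sumℕ a g +_) (sumℕ-cong r (λ j → sumℕ-cong a (λ u → cong g (+-assoc a (j * a) u)))) ⟩
  sumℕ a g + sumℕ r (λ j → sumℕ a (λ u → g (a + (j * a + u))))
    ≡⟨ cong (sumℕ a g +_) (sumℕ-blocks r a (λ t → g (a + t))) ⟩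
  sumℕ a g + sumℕ (r * a) (λ t → g (a + t))
    ≡⟨ sumℕ-+ a (r * a) g ⟨
  sumℕ (a + r * a) g ∎
  where open ≡-Reasoning

periodic-sumℕ-bound : ∀ m' (g : ℕ → ℕ) → (∀ t → g (suc m' + t) ≡ g t) → sumℕ (suc m') g ≡ 1 →
  ∀ N → suc m' * sumℕ N g ≤ N + m'
periodic-sumℕ-bound m' g periodic mass N = go N N (m≤m*n N M)
  where
  M = suc m'
  prefix≤1 : ∀ N → N ≤ M → sumℕ N g ≤ 1
  prefix≤1 N N≤M = begin
    sumℕ N g                                      ≤⟨ m≤m+n _ _ ⟩
    sumℕ N g + sumℕ (M ∸ N) (λ t → g (N + t))     ≡⟨ sumℕ-+ N (M ∸ N) g ⟨
    sumℕ (N + (M ∸ N)) g                          ≡⟨ cong (λ k → sumℕ k g) (m+[n∸m]≡n N≤M) ⟩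
    sumℕ M g                                      ≡⟨ mass ⟩
    1                                             ∎
    where open ≤-Reasoning
  go : ∀ q N → N ≤ q * M → M * sumℕ N g ≤ N + m'
  go q       zero    _     = ≤-trans (≤-reflexive (*-zeroʳ M)) z≤n
  go (suc q) (suc N) N≤qM with suc N ≤? M
  ... | yes N≤M = begin
    M * sumℕ (suc N) g   ≤⟨ *-monoʳ-≤ M (prefix≤1 (suc N) N≤M) ⟩
    M * 1                ≡⟨ *-identityʳ M ⟩
    suc m'               ≤⟨ s≤s (m≤n+m m' N) ⟩
    suc N + m'           ∎
    where open ≤-Reasoning
  ... | no N≰M with m≤n⇒∃[o]m+o≡n (<⇒≤ (≰⇒> N≰M))
  ...   | N′ , refl = begin
    M * sumℕ (M + N′) g                             ≡⟨ cong (M *_) (sumℕ-+ M N′ g) ⟩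
    M * (sumℕ M g + sumℕ N′ (λ t → g (M + t)))      ≡⟨ cong (M *_) (cong₂ _+_ mass (sumℕ-cong N′ periodic)) ⟩
    M * (1 + sumℕ N′ g)                             ≡⟨ *-distribˡ-+ M 1 (sumℕ N′ g) ⟩
    M * 1 + M * sumℕ N′ g
      ≤⟨ +-mono-≤ (≤-reflexive (*-identityʳ M)) (go q N′ (+-cancelˡ-≤ M N′ (q * M) N≤qM)) ⟩
    M + (N′ + m')                                   ≡⟨ +-assoc M N′ m' ⟨
    M + N′ + m'                                     ∎
    where open ≤-Reasoning

-- Sorting and splitting the columns

punchIn-<ᵇ : ∀ {k} (j : Fin (suc k)) (p : Fin k) → (toℕ (punchIn j p) <ᵇ toℕ j) ≡ (toℕ p <ᵇ toℕ j)
punchIn-<ᵇ fzero    p        = refl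
punchIn-<ᵇ (fsuc j) fzero    = refl
punchIn-<ᵇ (fsuc j) (fsuc p) = punchIn-<ᵇ j p

sortPerm : ∀ {k} → (Fin k → Bool) → Permutation′ k
sortPerm {zero}  P = id
sortPerm {suc k} P =
  insert fzero (if P fzero then fzero else fromℕ< (s≤s (count≤ (λ i → P (fsuc i))))) (sortPerm (λ i → P (fsuc i)))

sortPerm-<ᵇ : ∀ {k} (P : Fin k → Bool) i → (toℕ (sortPerm P ⟨$⟩ʳ i) <ᵇ count P) ≡ P i
sortPerm-<ᵇ {suc k} P = go
  where
  P′ : Fin k → Bool
  P′ i = P (fsuc i)
  c = count P′
  c<1+k : c < suc k
  c<1+k = s≤s (count≤ P′)
  pivot : Bool → Fin (suc k)
  pivot b = if b then fzero else fromℕ< c<1+k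
  pivot-<ᵇ : ∀ b → (toℕ (pivot b) <ᵇ (𝟙 b + c)) ≡ b
  pivot-<ᵇ true  = refl
  pivot-<ᵇ false = trans (cong (_<ᵇ c) (toℕ-fromℕ< c<1+k)) (n<ᵇn c)
  punchIn-pivot-<ᵇ : ∀ b p → (toℕ (punchIn (pivot b) p) <ᵇ (𝟙 b + c)) ≡ (toℕ p <ᵇ c)
  punchIn-pivot-<ᵇ true  p = refl
  punchIn-pivot-<ᵇ false p =
    subst (λ t → (toℕ (punchIn (pivot false) p) <ᵇ t) ≡ (toℕ p <ᵇ t)) (toℕ-fromℕ< c<1+k) (punchIn-<ᵇ (pivot false) p)
  go : ∀ i → (toℕ (sortPerm P ⟨$⟩ʳ i) <ᵇ count P) ≡ P i
  go fzero    = pivot-<ᵇ (P fzero)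
  go (fsuc i) = trans (punchIn-pivot-<ᵇ (P fzero) (sortPerm P′ ⟨$⟩ʳ i)) (sortPerm-<ᵇ P′ i)

sortSplit : ∀ {n r s} → (Fin n → Bool) → n ≡ r + s → Fin n ↔ (Fin r ⊎ Fin s)
sortSplit P n≡r+s = +↔⊎ ↔-∘ (sortPerm P ∘ₚ cast-id n≡r+s)

sortSplit-left : ∀ {n r s} (P : Fin n → Bool) (n≡r+s : n ≡ r + s) → r ≤ count P →
  ∀ j → P (Inverse.from (sortSplit P n≡r+s) (inj₁ j)) ≡ true
sortSplit-left {r = r} {s} P n≡r+s r≤P j = trans (sym (sortPerm-<ᵇ P y)) (<ᵇ-true (begin-strict
  toℕ (sortPerm P ⟨$⟩ʳ y)       ≡⟨ cong toℕ (inverseʳ (sortPerm P)) ⟩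
  toℕ (cast _ (j ↑ˡ s))         ≡⟨ toℕ-cast _ (j ↑ˡ s) ⟩
  toℕ (j ↑ˡ s)                  ≡⟨ toℕ-↑ˡ j s ⟩
  toℕ j                         <⟨ toℕ<n j ⟩
  r                             ≤⟨ r≤P ⟩
  count P                       ∎))
  where
  open ≤-Reasoning
  y = Inverse.from (sortSplit P n≡r+s) (inj₁ j)

transpose-cases : ∀ {n} (i j k : Fin n) →
  (k ≡ i × PC.transpose i j k ≡ j) ⊎ (k ≡ j × PC.transpose i j k ≡ i) ⊎ PC.transpose i j k ≡ k
transpose-cases i j k with k ≟ᶠ i
... | yes k≡i = inj₁ (k≡i , refl)
... | no _ with k ≟ᶠ j
...   | yes k≡j = inj₂ (inj₁ (k≡j , refl))
...   | no _    = inj₂ (inj₂ refl)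

transpose-same : ∀ {n} (i j : Fin n) → PC.transpose i j i ≡ j
transpose-same i j rewrite dec-true (i ≟ᶠ i) refl = refl

pinSplit : ∀ {n r s} → Fin n ↔ (Fin (suc r) ⊎ Fin s) → Fin n → Fin n ↔ (Fin (suc r) ⊎ Fin s)
pinSplit θ y₁ = θ ↔-∘ transpose y₁ (Inverse.from θ (inj₁ fzero))

pinSplit-pinned : ∀ {n r s} (θ : Fin n ↔ (Fin (suc r) ⊎ Fin s)) y₁ → Inverse.from (pinSplit θ y₁) (inj₁ fzero) ≡ y₁
pinSplit-pinned θ y₁ = transpose-same (Inverse.from θ (inj₁ fzero)) y₁

pinSplit-left : ∀ {n r s} (θ : Fin n ↔ (Fin (suc r) ⊎ Fin s)) y₁ (P : Fin n → Bool) →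
  (∀ j → P (Inverse.from θ (inj₁ j)) ≡ true) →
  ∀ j → Inverse.from (pinSplit θ y₁) (inj₁ j) ≡ y₁ ⊎ P (Inverse.from (pinSplit θ y₁) (inj₁ j)) ≡ true
pinSplit-left θ y₁ P left-P j with transpose-cases (Inverse.from θ (inj₁ fzero)) y₁ (Inverse.from θ (inj₁ j))
... | inj₁ (_ , to-y₁)       = inj₁ to-y₁
... | inj₂ (inj₁ (_ , to-y₀)) = inj₂ (trans (cong P to-y₀) (left-P fzero))
... | inj₂ (inj₂ fixed)       = inj₂ (trans (cong P fixed) (left-P j))

_⊆_ : ∀ {m n} → (Fin m → Fin n → Bool) → (Fin m → Fin n → Bool) → Set
F ⊆ R = ∀ x y → F x y ≡ true → R x y ≡ true

nonEdges : ∀ {m n} → (Fin m → Fin n → Bool) → ℕ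
nonEdges R = sumFin (λ x → count (λ y → not (R x y)))

nonEdges>0 : ∀ {m n} (R : Fin m → Fin n → Bool) {x y} → R x y ≡ false → 0 < nonEdges R
nonEdges>0 R {x} {y} Rxy = ≤-trans (count>0 (λ y′ → not (R x y′)) (cong not Rxy))
                                   (≤-sumFin (λ x′ → count (λ y′ → not (R x′ y′))) x)

nonEdge-witness : ∀ {m n} (R : Fin m → Fin n → Bool) → 0 < nonEdges R → Σ (Fin m) λ x → Σ (Fin n) λ y → R x y ≡ false
nonEdge-witness R 0<nonEdges with sumFin>0 (λ x → count (λ y → not (R x y))) 0<nonEdges
... | x , 0<row with count>0⁻¹ (λ y → not (R x y)) 0<row
...   | y , notRxy = x , y , not-injective notRxy

nonEdges-column : ∀ {m n} (R : Fin m → Fin n → Bool) y₁ → (∀ x y → R x y ≡ false → y ≡ y₁) →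
  nonEdges R ≡ count (λ x → not (R x y₁))
nonEdges-column R y₁ in-column = trans (sym (sumFin-count-comm (λ x y → not (R x y))))
  (sumFin-single (λ y → count (λ x → not (R x y))) y₁ (λ y y≢y₁ → count-all-false (λ x → off-column x y y≢y₁)))
  where
  off-column : ∀ x y → y ≢ y₁ → not (R x y) ≡ false
  off-column x y y≢y₁ with R x y in Rxy
  ... | true  = refl
  ... | false = contradiction (in-column x y Rxy) y≢y₁

nonEdges-row : ∀ {m n} (R : Fin m → Fin n → Bool) x₁ → (∀ x y → R x y ≡ false → x ≡ x₁) →
  nonEdges R ≡ count (λ y → not (R x₁ y))
nonEdges-row R x₁ in-row =
  sumFin-single (λ x → count (λ y → not (R x y))) x₁ (λ x x≢x₁ → count-all-false (λ y → off-row x y x≢x₁))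
  where
  off-row : ∀ x y → x ≢ x₁ → not (R x y) ≡ false
  off-row x y x≢x₁ with R x y in Rxy
  ... | true  = refl
  ... | false = contradiction (in-row x y Rxy) x≢x₁

edges+nonEdges : ∀ m n (E : Fin m → Fin n → Bool) → edges (bip m n E) + nonEdges E ≡ m * n
edges+nonEdges m n E = begin
  edges (bip m n E) + nonEdges E
    ≡⟨ sumFin-distrib-+ (λ x → count (E x)) (λ x → count (λ y → not (E x y))) ⟨
  sumFin (λ x → count (E x) + count (λ y → not (E x y)))    ≡⟨ sumFin-cong (λ x → count-compl (E x)) ⟩
  sumFin {m} (λ _ → n)                                      ≡⟨ sumFin-const {m} n ⟩
  m * n                                                     ∎
  where open ≡-Reasoning

module ColumnSplit {n r s : ℕ} (θ : Fin n ↔ (Fin r ⊎ Fin s)) where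

  open Inverse θ public using (to; from)
  open Inverse θ using (strictlyInverseˡ; strictlyInverseʳ)

  from-injective : ∀ {u v} → from u ≡ from v → u ≡ v
  from-injective {u} {v} eq = trans (sym (strictlyInverseˡ u)) (trans (cong to eq) (strictlyInverseˡ v))

  left : ∀ {m} → (Fin m → Fin n → Bool) → Fin m → Fin r → Bool
  left R x j = R x (from (inj₁ j))

  right : ∀ {m} → (Fin m → Fin n → Bool) → Fin m → Fin s → Bool
  right R x i = R x (from (inj₂ i))

  glue : ∀ {m} → (Fin m → Fin r → Bool) → (Fin m → Fin s → Bool) → Fin m → Fin n → Bool
  glue F₁ F₂ x y = Sum.[ F₁ x , F₂ x ]′ (to y)

  degX-glue : ∀ {m} (F₁ : Fin m → Fin r → Bool) F₂ x → degX (glue F₁ F₂) x ≡ degX F₁ x + degX F₂ x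
  degX-glue F₁ F₂ x = count-↔⊎ θ Sum.[ F₁ x , F₂ x ]′

  degY-glue : ∀ {m} (F₁ : Fin m → Fin r → Bool) F₂ y → degY (glue F₁ F₂) y ≡ Sum.[ degY F₁ , degY F₂ ]′ (to y)
  degY-glue F₁ F₂ y with to y
  ... | inj₁ j = refl
  ... | inj₂ i = refl

  from-to : ∀ {y u} → to y ≡ u → from u ≡ y
  from-to {y} refl = strictlyInverseʳ y

  glue-⊆ : ∀ {m} {R : Fin m → Fin n → Bool} {F₁ F₂} → F₁ ⊆ left R → F₂ ⊆ right R → glue F₁ F₂ ⊆ R
  glue-⊆ {R = R} F₁⊆R₁ F₂⊆R₂ x y Fxy with to y in toy
  ... | inj₁ j = subst (λ v → R x v ≡ true) (from-to toy) (F₁⊆R₁ x j Fxy)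
  ... | inj₂ i = subst (λ v → R x v ≡ true) (from-to toy) (F₂⊆R₂ x i Fxy)

  nonEdges-split : ∀ {m} (R : Fin m → Fin n → Bool) → nonEdges R ≡ nonEdges (left R) + nonEdges (right R)
  nonEdges-split R = begin
    sumFin (λ x → count (λ y → not (R x y)))
      ≡⟨ sumFin-cong (λ x → count-cong (λ y → cong (λ v → not (R x v)) (strictlyInverseʳ y))) ⟨
    sumFin (λ x → count (λ y → not (R x (from (to y)))))
      ≡⟨ sumFin-cong (λ x → count-↔⊎ θ (λ u → not (R x (from u)))) ⟩
    sumFin (λ x → count (λ j → not (left R x j)) + count (λ i → not (right R x i)))
      ≡⟨ sumFin-distrib-+ (λ x → count (λ j → not (left R x j))) (λ x → count (λ i → not (right R x i))) ⟩
    nonEdges (left R) + nonEdges (right R) ∎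
    where open ≡-Reasoning

  glue-isFactor : ∀ {a b m} {E : Fin m → Fin n → Bool} {F₁ F₂} → F₁ ⊆ left E → F₂ ⊆ right E →
    (∀ x → a ≤ degX F₁ x + degX F₂ x × degX F₁ x + degX F₂ x ≤ b) →
    (∀ j → a ≤ degY F₁ j × degY F₁ j ≤ b) → (∀ i → a ≤ degY F₂ i × degY F₂ i ≤ b) →
    IsFactor a b (bip m n E) (glue F₁ F₂)
  glue-isFactor {a} {b} {F₁ = F₁} {F₂} F₁⊆E₁ F₂⊆E₂ rows columns₁ columns₂ =
    glue-⊆ F₁⊆E₁ F₂⊆E₂ ,
    (λ x → subst (λ d → a ≤ d × d ≤ b) (sym (degX-glue F₁ F₂ x)) (rows x)) ,
    (λ y → subst (λ d → a ≤ d × d ≤ b) (sym (degY-glue F₁ F₂ y)) (columns (to y)))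
    where
    columns : ∀ u → a ≤ Sum.[ degY F₁ , degY F₂ ]′ u × Sum.[ degY F₁ , degY F₂ ]′ u ≤ b
    columns (inj₁ j) = columns₁ j
    columns (inj₂ i) = columns₂ i

-- Cyclic constructions on M rows

module Cyclic (m' : ℕ) where

  M : ℕ
  M = suc m'

  toℕ-mod : ∀ k → toℕ (k mod M) ≡ k % M
  toℕ-mod k = toℕ-fromℕ< (m%n<n k M)

  mod-cong : ∀ k l → k % M ≡ l % M → k mod M ≡ l mod M
  mod-cong k l eq = toℕ-injective (trans (toℕ-mod k) (trans eq (sym (toℕ-mod l))))

  toℕ-mod-id : ∀ (v : Fin M) → toℕ v mod M ≡ v
  toℕ-mod-id v = toℕ-injective (trans (toℕ-mod (toℕ v)) (m<n⇒m%n≡m (toℕ<n v)))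

  +-mod : ∀ c k → (c + toℕ (k mod M)) mod M ≡ (c + k) mod M
  +-mod c k = mod-cong (c + toℕ (k mod M)) (c + k) (begin
    (c + toℕ (k mod M)) % M       ≡⟨ cong (λ t → (c + t) % M) (toℕ-mod k) ⟩
    (c + k % M) % M               ≡⟨ %-distribˡ-+ c (k % M) M ⟩
    (c % M + k % M % M) % M       ≡⟨ cong (λ t → (c % M + t) % M) (m%n%n≡m%n k M) ⟩
    (c % M + k % M) % M           ≡⟨ %-distribˡ-+ c k M ⟨
    (c + k) % M                   ∎)
    where open ≡-Reasoning

  +*M-mod : ∀ k c → (k + c * M) mod M ≡ k mod M
  +*M-mod k c = mod-cong (k + c * M) k ([m+kn]%n≡m%n k c M)

  -- m' acts as −1 modulo M, so adding m' * c undoes adding c.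
  +-m'*-cancel : ∀ c v → c + (v + m' * c) ≡ v + c * M
  +-m'*-cancel c v = solve 3 (λ c v m → c :+ (v :+ m :* c) := v :+ c :* (con 1 :+ m)) refl c v m'

  rotate : ℕ → Permutation′ M
  rotate c = permutation (λ v → (c + toℕ v) mod M) (λ v → (toℕ v + m' * c) mod M) forth back
    where
    forth : ∀ v → (c + toℕ ((toℕ v + m' * c) mod M)) mod M ≡ v
    forth v = begin
      (c + toℕ ((toℕ v + m' * c) mod M)) mod M   ≡⟨ +-mod c (toℕ v + m' * c) ⟩
      (c + (toℕ v + m' * c)) mod M               ≡⟨ cong (_mod M) (+-m'*-cancel c (toℕ v)) ⟩
      (toℕ v + c * M) mod M                      ≡⟨ +*M-mod (toℕ v) c ⟩
      toℕ v mod M                                ≡⟨ toℕ-mod-id v ⟩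
      v                                          ∎
      where open ≡-Reasoning
    back : ∀ v → (toℕ ((c + toℕ v) mod M) + m' * c) mod M ≡ v
    back v = begin
      (toℕ ((c + toℕ v) mod M) + m' * c) mod M   ≡⟨ cong (_mod M) (+-comm (toℕ ((c + toℕ v) mod M)) (m' * c)) ⟩
      (m' * c + toℕ ((c + toℕ v) mod M)) mod M   ≡⟨ +-mod (m' * c) (c + toℕ v) ⟩
      (m' * c + (c + toℕ v)) mod M               ≡⟨ cong (_mod M) (eq (toℕ v)) ⟩
      (c + (toℕ v + m' * c)) mod M               ≡⟨ cong (_mod M) (+-m'*-cancel c (toℕ v)) ⟩
      (toℕ v + c * M) mod M                      ≡⟨ +*M-mod (toℕ v) c ⟩
      toℕ v mod M                                ≡⟨ toℕ-mod-id v ⟩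
      v                                          ∎
      where
      open ≡-Reasoning
      eq : ∀ t → m' * c + (c + t) ≡ c + (t + m' * c)
      eq t = trans (+-comm (m' * c) (c + t)) (+-assoc c t (m' * c))

  rotate-comm : ∀ (u v : Fin M) → rotate (toℕ u) ⟨$⟩ʳ v ≡ rotate (toℕ v) ⟨$⟩ʳ u
  rotate-comm u v = cong (_mod M) (+-comm (toℕ u) (toℕ v))

  rotate-injectiveˡ : ∀ {i j x : Fin M} → rotate (toℕ i) ⟨$⟩ʳ x ≡ rotate (toℕ j) ⟨$⟩ʳ x → i ≡ j
  rotate-injectiveˡ {i} {j} {x} eq = trans (sym (inverseˡ π)) (trans (cong (π ⟨$⟩ˡ_) πi≡πj) (inverseˡ π))
    where
    π = rotate (toℕ x)
    πi≡πj : π ⟨$⟩ʳ i ≡ π ⟨$⟩ʳ j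
    πi≡πj = trans (rotate-comm x i) (trans eq (rotate-comm j x))

  residue : Permutation′ M → Fin M → Fin M → Fin M
  residue σ x i = rotate (toℕ i) ⟨$⟩ʳ (σ ⟨$⟩ʳ x)

  circulant : (Fin M → Bool) → Permutation′ M → Fin M → Fin M → Bool
  circulant T σ x i = T (residue σ x i)

  degX-circulant : ∀ T σ x → degX (circulant T σ) x ≡ count T
  degX-circulant T σ x = begin
    degX (circulant T σ) x                            ≡⟨ count-cong (λ i → cong T (rotate-comm i (σ ⟨$⟩ʳ x))) ⟩
    count (λ i → T (rotate (toℕ (σ ⟨$⟩ʳ x)) ⟨$⟩ʳ i))   ≡⟨ count-permute T (rotate (toℕ (σ ⟨$⟩ʳ x))) ⟨
    count T                                           ∎
    where open ≡-Reasoning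

  degY-circulant : ∀ T σ i → degY (circulant T σ) i ≡ count T
  degY-circulant T σ i = begin
    degY (circulant T σ) i                            ≡⟨ count-permute (λ z → T (rotate (toℕ i) ⟨$⟩ʳ z)) σ ⟨
    count (λ z → T (rotate (toℕ i) ⟨$⟩ʳ z))            ≡⟨ count-permute T (rotate (toℕ i)) ⟨
    count T                                           ∎
    where open ≡-Reasoning

  lands : (Fin M → Fin M → Bool) → Permutation′ M → Fin M → Fin M → Fin M → Bool
  lands R σ z x i = not (R x i) ∧ does (z ≟ᶠ residue σ x i)

  nonEdgesAt : (Fin M → Fin M → Bool) → Permutation′ M → Fin M → ℕ
  nonEdgesAt R σ z = sumFin (λ x → count (lands R σ z x))

  blocked : (Fin M → Fin M → Bool) → Permutation′ M → Fin M → Bool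
  blocked R σ z = 0 <ᵇ nonEdgesAt R σ z

  lands-residue : ∀ (R : Fin M → Fin M → Bool) σ {x i} → R x i ≡ false → lands R σ (residue σ x i) x i ≡ true
  lands-residue R σ {x} {i} Rxi = cong₂ _∧_ (cong not Rxi) (dec-true (residue σ x i ≟ᶠ residue σ x i) refl)

  nonEdgesAt>0 : ∀ (R : Fin M → Fin M → Bool) σ {x i} → R x i ≡ false → 0 < nonEdgesAt R σ (residue σ x i)
  nonEdgesAt>0 R σ {x} {i} Rxi =
    ≤-trans (count>0 (lands R σ w x) (lands-residue R σ Rxi)) (≤-sumFin (λ x′ → count (lands R σ w x′)) x)
    where w = residue σ x i

  count-blocked≤ : ∀ (R : Fin M → Fin M → Bool) σ → count (blocked R σ) ≤ nonEdges R
  count-blocked≤ R σ = ≤-trans (count-nonzero≤sumFin (nonEdgesAt R σ))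
                               (≤-reflexive (sumFin-fibres (λ x i → not (R x i)) (residue σ)))

  count-blocked< : ∀ (R : Fin M → Fin M → Bool) σ {x₁ i₁ x₂ i₂} → x₁ ≢ x₂ → R x₁ i₁ ≡ false → R x₂ i₂ ≡ false →
    residue σ x₁ i₁ ≡ residue σ x₂ i₂ → count (blocked R σ) < nonEdges R
  count-blocked< R σ {x₁} {i₁} {x₂} {i₂} x₁≢x₂ R₁ R₂ same = begin-strict
    count (blocked R σ)     <⟨ count-nonzero<sumFin (nonEdgesAt R σ) w 1<nonEdgesAt ⟩
    sumFin (nonEdgesAt R σ) ≡⟨ sumFin-fibres (λ x i → not (R x i)) (residue σ) ⟩
    nonEdges R              ∎
    where
    open ≤-Reasoning
    w = residue σ x₁ i₁
    1<nonEdgesAt : 1 < nonEdgesAt R σ w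
    1<nonEdgesAt = ≤-trans (+-mono-≤ (count>0 (lands R σ w x₁) (lands-residue R σ R₁))
                                     (count>0 (lands R σ w x₂) (subst (λ v → lands R σ v x₂ i₂ ≡ true) (sym same)
                                                                      (lands-residue R σ R₂))))
                           (+-≤-sumFin (λ x → count (lands R σ w x)) x₁≢x₂)

  circulant-⊆ : ∀ (R : Fin M → Fin M → Bool) σ T → (∀ z → T z ≡ true → blocked R σ z ≡ false) → circulant T σ ⊆ R
  circulant-⊆ R σ T T-unblocked x i Tz with R x i in Rxi
  ... | true  = refl
  ... | false = contradiction (trans (sym (<ᵇ-true (nonEdgesAt>0 R σ Rxi))) (T-unblocked _ Tz)) λ ()

  unblocked-circulant : ∀ a (R : Fin M → Fin M → Bool) σ → count (blocked R σ) + a ≤ M →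
    Σ (Fin M → Fin M → Bool) λ F → F ⊆ R × (∀ x → degX F x ≡ a) × (∀ i → degY F i ≡ a)
  unblocked-circulant a R σ few-blocked =
    circulant T σ , circulant-⊆ R σ T T-unblocked ,
    (λ x → trans (degX-circulant T σ x) count-T) , (λ i → trans (degY-circulant T σ i) count-T)
    where
    unblocked : Fin M → Bool
    unblocked z = not (blocked R σ z)
    T = takeTrue a unblocked
    count-T : count T ≡ a
    count-T = count-takeTrue a unblocked (+-cancelˡ-≤ (count (blocked R σ)) a (count unblocked)
                (≤-trans few-blocked (≤-reflexive (sym (count-compl (blocked R σ))))))
    T-unblocked : ∀ z → T z ≡ true → blocked R σ z ≡ false
    T-unblocked z Tz = not-injective (takeTrue-⊆ a unblocked z Tz)

  residue-collision : ∀ {x₁ x₂ i₁ i₂ : Fin M} → x₁ ≢ x₂ → i₁ ≢ i₂ →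
    Σ (Permutation′ M) λ σ → residue σ x₁ i₁ ≡ residue σ x₂ i₂
  residue-collision {x₁} {x₂} {i₁} {i₂} x₁≢x₂ i₁≢i₂ = σ , trans (cong (rotate (toℕ i₁) ⟨$⟩ʳ_) σx₁≡x₁) (sym w≡)
    where
    w = rotate (toℕ i₁) ⟨$⟩ʳ x₁
    z = rotate (toℕ i₂) ⟨$⟩ˡ w
    σ = transpose x₂ z
    w≡ : rotate (toℕ i₂) ⟨$⟩ʳ (σ ⟨$⟩ʳ x₂) ≡ w
    w≡ = trans (cong (rotate (toℕ i₂) ⟨$⟩ʳ_) (transpose-same x₂ z)) (inverseʳ (rotate (toℕ i₂)))
    x₁≢z : x₁ ≢ z
    x₁≢z x₁≡z =
      i₁≢i₂ (sym (rotate-injectiveˡ (trans (cong (rotate (toℕ i₂) ⟨$⟩ʳ_) x₁≡z) (inverseʳ (rotate (toℕ i₂))))))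
    σx₁≡x₁ : σ ⟨$⟩ʳ x₁ ≡ x₁
    σx₁≡x₁ with transpose-cases x₂ z x₁
    ... | inj₁ (x₁≡x₂ , _)       = contradiction x₁≡x₂ x₁≢x₂
    ... | inj₂ (inj₁ (x₁≡z , _)) = contradiction x₁≡z x₁≢z
    ... | inj₂ (inj₂ fixed)      = fixed

  -- Tile j is the cyclic interval of a rows starting at e + j a, so the tiles deal the slots
  -- t = 0, 1, 2, … to the rows (e + t) mod M in turn.
  tiles : ∀ {r} → ℕ → ℕ → Fin M → Fin r → Bool
  tiles a e x j = toℕ (rotate (e + toℕ j * a) ⟨$⟩ˡ x) <ᵇ a

  degY-tiles : ∀ {r} a e (j : Fin r) → a ≤ M → degY (tiles a e) j ≡ a
  degY-tiles a e j a≤M = begin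
    degY (tiles a e) j           ≡⟨ count-permute (λ z → toℕ z <ᵇ a) (flip (rotate (e + toℕ j * a))) ⟨
    count {M} (λ z → toℕ z <ᵇ a) ≡⟨ count-<ᵇ a a≤M ⟩
    a                            ∎
    where open ≡-Reasoning

  dealt : ℕ → Fin M → ℕ → ℕ
  dealt e x t = 𝟙 (does ((e + t) mod M ≟ᶠ x))

  dealt-periodic : ∀ e x t → dealt e x (M + t) ≡ dealt e x t
  dealt-periodic e x t = cong (λ v → 𝟙 (does (v ≟ᶠ x))) (trans (cong (_mod M) e+M+t) (+*M-mod (e + t) 1))
    where
    e+M+t : e + (M + t) ≡ e + t + 1 * M
    e+M+t = trans (cong (e +_) (+-comm M t)) (trans (sym (+-assoc e t M)) (cong (e + t +_) (sym (*-identityˡ M))))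

  dealt-mass : ∀ e x → sumℕ M (dealt e x) ≡ 1
  dealt-mass e x = begin
    sumℕ M (dealt e x)                                  ≡⟨ sumFin-toℕ {M} (dealt e x) ⟨
    sumFin {M} (λ i → 𝟙 (does (rotate e ⟨$⟩ʳ i ≟ᶠ x)))  ≡⟨ count≡sum𝟙 (λ i → does (rotate e ⟨$⟩ʳ i ≟ᶠ x)) ⟨
    count (λ i → does (rotate e ⟨$⟩ʳ i ≟ᶠ x))           ≡⟨ count-permute (λ z → does (z ≟ᶠ x)) (rotate e) ⟨
    count (λ z → does (z ≟ᶠ x))                         ≡⟨ count-≟ x ⟩
    1                                                 ∎
    where open ≡-Reasoning

  tiles-dealt : ∀ {r} a e x (j : Fin r) → 𝟙 (tiles a e x j) ≤ sumℕ a (λ u → dealt e x (toℕ j * a + u))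
  tiles-dealt a e x j with tiles a e x j in tile
  ... | false = z≤n
  ... | true  = subst (_≤ sumℕ a (λ u → dealt e x (toℕ j * a + u))) hit
                      (≤-sumℕ a (λ u → dealt e x (toℕ j * a + u)) (<ᵇ-true⁻¹ tile))
    where
    c = e + toℕ j * a
    v = rotate c ⟨$⟩ˡ x
    hit : dealt e x (toℕ j * a + toℕ v) ≡ 1
    hit = trans (cong (λ w → 𝟙 (does (w ≟ᶠ x))) (trans (cong (_mod M) (sym (+-assoc e (toℕ j * a) (toℕ v))))
                                                       (inverseʳ (rotate c) {x})))
                (cong 𝟙 (dec-true (x ≟ᶠ x) refl))

  M*degX-tiles≤ : ∀ {r} a e x → M * degX (tiles {r} a e) x ≤ r * a + m'
  M*degX-tiles≤ {r} a e x = begin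
    M * degX (tiles {r} a e) x                                       ≡⟨ cong (M *_) (count≡sum𝟙 (tiles {r} a e x)) ⟩
    M * sumFin {r} (λ j → 𝟙 (tiles a e x j))                         ≤⟨ *-monoʳ-≤ M (sumFin-mono-≤ {r} (tiles-dealt a e x)) ⟩
    M * sumFin {r} (λ j → sumℕ a (λ u → dealt e x (toℕ j * a + u)))
      ≡⟨ cong (M *_) (sumFin-toℕ {r} (λ j → sumℕ a (λ u → dealt e x (j * a + u)))) ⟩
    M * sumℕ r (λ j → sumℕ a (λ u → dealt e x (j * a + u)))          ≡⟨ cong (M *_) (sumℕ-blocks r a (dealt e x)) ⟩
    M * sumℕ (r * a) (dealt e x)
      ≤⟨ periodic-sumℕ-bound m' (dealt e x) (dealt-periodic e x) (dealt-mass e x) (r * a) ⟩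
    r * a + m'                                                       ∎
    where open ≤-Reasoning

  first-tile-avoids : ∀ {r} a x → a ≤ m' → tiles {suc r} a (toℕ x + 1) x fzero ≡ false
  first-tile-avoids a x a≤m' = <ᵇ-false (subst (a ≤_) (sym m'-pos) a≤m')
    where
    m'-pos : toℕ ((toℕ x + m' * (toℕ x + 1 + 0)) mod M) ≡ m'
    m'-pos = begin
      toℕ ((toℕ x + m' * (toℕ x + 1 + 0)) mod M)   ≡⟨ toℕ-mod (toℕ x + m' * (toℕ x + 1 + 0)) ⟩
      (toℕ x + m' * (toℕ x + 1 + 0)) % M
        ≡⟨ cong (_% M) (solve 2 (λ x m → x :+ m :* (x :+ con 1 :+ con 0) := m :+ x :* (con 1 :+ m)) refl (toℕ x) m') ⟩
      (m' + toℕ x * M) % M                         ≡⟨ [m+kn]%n≡m%n m' (toℕ x) M ⟩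
      m' % M                                       ≡⟨ m<n⇒m%n≡m ≤-refl ⟩
      m'                                           ∎
      where
      open ≡-Reasoning

  degX-tiles+a≤b : ∀ {r} a b e x → a * (r + M) ≤ b * M → degX (tiles {r} a e) x + a ≤ b
  degX-tiles+a≤b {r} a b e x a[r+M]≤bM = s≤s⁻¹ (*-cancelˡ-< M _ _ (begin-strict
    M * (L + a)            ≡⟨ *-distribˡ-+ M L a ⟩
    M * L + M * a          ≤⟨ +-monoˡ-≤ (M * a) (M*degX-tiles≤ {r} a e x) ⟩
    r * a + m' + M * a     ≡⟨ solve 4 (λ r a m M → r :* a :+ m :+ M :* a := a :* (r :+ M) :+ m) refl r a m' M ⟩
    a * (r + M) + m'       ≤⟨ +-monoˡ-≤ m' a[r+M]≤bM ⟩
    b * M + m'             <⟨ +-monoʳ-< (b * M) ≤-refl ⟩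
    b * M + M              ≡⟨ solve 2 (λ b M → b :* M :+ M := M :* (con 1 :+ b)) refl b M ⟩
    M * suc b              ∎))
    where
    L = degX (tiles {r} a e) x
    open ≤-Reasoning

  layout-factor : ∀ {n r} a b (E : Fin M → Fin n → Bool) (θ : Fin n ↔ (Fin r ⊎ Fin M)) e σ → a ≤ b → a * n ≤ b * M →
    tiles a e ⊆ ColumnSplit.left θ E → count (blocked (ColumnSplit.right θ E) σ) + a ≤ M → HasFactor a b (bip M n E)
  layout-factor {n} {r} a b E θ e σ a≤b an≤bM tiles⊆E₁ few-blocked =
    glue tiling square ,
    glue-isFactor tiles⊆E₁ square⊆E₂ rows (λ j → exactly-a (degY-tiles a e j a≤M)) (λ i → exactly-a (degY-square i))
    where
    open ColumnSplit θ
    tiling : Fin M → Fin r → Bool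
    tiling = tiles a e
    regular = unblocked-circulant a (right E) σ few-blocked
    square : Fin M → Fin M → Bool
    square = proj₁ regular
    square⊆E₂ : square ⊆ right E
    square⊆E₂ = proj₁ (proj₂ regular)
    degX-square : ∀ x → degX square x ≡ a
    degX-square = proj₁ (proj₂ (proj₂ regular))
    degY-square : ∀ i → degY square i ≡ a
    degY-square = proj₂ (proj₂ (proj₂ regular))
    a≤M : a ≤ M
    a≤M = ≤-trans (m≤n+m a _) few-blocked
    exactly-a : ∀ {d} → d ≡ a → a ≤ d × d ≤ b
    exactly-a refl = ≤-refl , a≤b
    rows : ∀ x → a ≤ degX tiling x + degX square x × degX tiling x + degX square x ≤ b
    rows x = subst (λ d → a ≤ degX tiling x + d × degX tiling x + d ≤ b) (sym (degX-square x))
      (m≤n+m a _ , degX-tiles+a≤b a b e x (subst (λ k → a * k ≤ b * M) (↔⇒≡ (↔-sym +↔⊎ ↔-∘ θ)) an≤bM))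

-- Factors of graphs with few non-edges

module Factors {m' n : ℕ} (E : Fin (suc m') → Fin n → Bool) (M≤n : suc m' ≤ n) where

  open Cyclic m'

  incomplete : Fin n → Bool
  incomplete y = 0 <ᵇ count (λ x → not (E x y))

  count-incomplete≤ : count incomplete ≤ nonEdges E
  count-incomplete≤ = ≤-trans (count-nonzero≤sumFin (λ y → count (λ x → not (E x y))))
                              (≤-reflexive (sumFin-count-comm (λ x y → not (E x y))))

  complete : Fin n → Bool
  complete y = not (incomplete y)

  complete⇒edge : ∀ {y} → complete y ≡ true → ∀ x → E x y ≡ true
  complete⇒edge {y} y-complete x =
    not-injective (count≡0⇒false (λ x′ → not (E x′ y)) (0<ᵇ-false⁻¹ (not-injective y-complete)) x)
    where
    0<ᵇ-false⁻¹ : ∀ {c} → (0 <ᵇ c) ≡ false → c ≡ 0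
    0<ᵇ-false⁻¹ {zero} _ = refl

  r≤count-complete : nonEdges E ≤ M → ∀ {r} → n ≡ r + M → r ≤ count complete
  r≤count-complete k≤M {r} n≡r+M = +-cancelʳ-≤ M r (count complete) (begin
    r + M                                   ≡⟨ n≡r+M ⟨
    n                                       ≡⟨ count-compl incomplete ⟨
    count incomplete + count complete       ≤⟨ +-monoˡ-≤ (count complete) (≤-trans count-incomplete≤ k≤M) ⟩
    M + count complete                      ≡⟨ +-comm M (count complete) ⟩
    count complete + M                      ∎)
    where open ≤-Reasoning

  completeSplit : ∀ {r} → n ≡ r + M → Fin n ↔ (Fin r ⊎ Fin M)
  completeSplit = sortSplit complete

  completeSplit-complete : nonEdges E ≤ M → ∀ {r} (n≡r+M : n ≡ r + M) j →
    complete (Inverse.from (completeSplit n≡r+M) (inj₁ j)) ≡ true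
  completeSplit-complete k≤M n≡r+M = sortSplit-left complete n≡r+M (r≤count-complete k≤M n≡r+M)

  completeSplit-left : nonEdges E ≤ M → ∀ {r} (n≡r+M : n ≡ r + M) x j →
    ColumnSplit.left (completeSplit n≡r+M) E x j ≡ true
  completeSplit-left k≤M n≡r+M x j = complete⇒edge (completeSplit-complete k≤M n≡r+M j) x

  nonEdges-right≤ : ∀ {r} (θ : Fin n ↔ (Fin r ⊎ Fin M)) → nonEdges (ColumnSplit.right θ E) ≤ nonEdges E
  nonEdges-right≤ θ = ≤-trans (m≤n+m (nonEdges (right E)) (nonEdges (left E))) (≤-reflexive (sym (nonEdges-split E)))
    where open ColumnSplit θ

  n≡r+M : n ≡ (n ∸ M) + M
  n≡r+M = sym (m∸n+n≡m M≤n)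

  few-nonEdges-factor : ∀ {a b} → a ≤ b → a * n ≤ b * M → nonEdges E + a ≤ M → HasFactor a b (bip M n E)
  few-nonEdges-factor {a} {b} a≤b an≤bM few =
    layout-factor a b E θ 0 id a≤b an≤bM (λ x j _ → completeSplit-left k≤M n≡r+M x j)
                  (≤-trans (+-monoˡ-≤ a (≤-trans (count-blocked≤ (ColumnSplit.right θ E) id) (nonEdges-right≤ θ))) few)
    where
    θ = completeSplit n≡r+M
    k≤M = ≤-trans (m≤m+n _ a) few

  module _ {a b} (0<a : 0 < a) (a≤b : a ≤ b) (an≤bM : a * n ≤ b * M) (k+a≡1+M : nonEdges E + a ≡ suc M) where

    k≤M : nonEdges E ≤ M
    k≤M = +-cancelʳ-≤ 1 (nonEdges E) M (≤-trans (+-monoʳ-≤ (nonEdges E) 0<a) (≤-reflexive (trans k+a≡1+M (+-comm 1 M))))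

    fewer-blocked : ∀ {r} (θ : Fin n ↔ (Fin r ⊎ Fin M)) σ →
      count (blocked (ColumnSplit.right θ E) σ) < nonEdges E → count (blocked (ColumnSplit.right θ E) σ) + a ≤ M
    fewer-blocked θ σ blocked<k = +-cancelˡ-≤ 1 _ M (≤-trans (+-monoˡ-≤ a blocked<k) (≤-reflexive k+a≡1+M))

    private
      θ : Fin n ↔ (Fin (n ∸ M) ⊎ Fin M)
      θ = completeSplit n≡r+M
      open ColumnSplit θ

    in-square : ∀ {x y} → E x y ≡ false → Σ (Fin M) λ i → from (inj₂ i) ≡ y
    in-square {x} {y} Exy with to y in toy
    ... | inj₁ j = contradiction (trans (sym Exy) (trans (cong (E x) (sym (from-to toy))) (completeSplit-left k≤M n≡r+M x j))) λ ()
    ... | inj₂ i = i , from-to toy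

    -- The two non-edges land on the same residue, so at most k − 1 residues are blocked.
    crossing-factor : ∀ {x₁ y₁ x₂ y₂} → x₁ ≢ x₂ → y₁ ≢ y₂ → E x₁ y₁ ≡ false → E x₂ y₂ ≡ false →
      HasFactor a b (bip M n E)
    crossing-factor {x₁} {y₁} {x₂} {y₂} x₁≢x₂ y₁≢y₂ E₁ E₂ with in-square E₁ | in-square E₂
    ... | i₁ , col₁ | i₂ , col₂
      with residue-collision x₁≢x₂ (λ i₁≡i₂ → y₁≢y₂ (trans (sym col₁) (trans (cong (λ i → from (inj₂ i)) i₁≡i₂) col₂)))
    ...   | σ , collide =
      layout-factor a b E θ 0 σ a≤b an≤bM (λ x j _ → completeSplit-left k≤M n≡r+M x j)
        (fewer-blocked θ σ (<-≤-trans (count-blocked< (right E) σ x₁≢x₂ (trans (cong (E x₁) col₁) E₁)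
                                                                       (trans (cong (E x₂) col₂) E₂) collide)
                                      (nonEdges-right≤ θ)))

    -- Column y₁ becomes the first tile column, whose interval starts just after x₁, so the
    -- square keeps only k − 1 non-edges.
    row-star-factor : M < n → a ≤ m' → ∀ {x₁ y₁} → E x₁ y₁ ≡ false → (∀ x y → E x y ≡ false → x ≡ x₁) →
      HasFactor a b (bip M n E)
    row-star-factor M<n a≤m' {x₁} {y₁} Ex₁y₁ in-row with m≤n⇒∃[o]m+o≡n M<n
    ... | r , 1+M+r≡n = layout-factor a b E θ★ (toℕ x₁ + 1) id a≤b an≤bM tiles⊆E₁ (fewer-blocked θ★ id blocked<k)
      where
      n≡1+r+M : n ≡ suc r + M
      n≡1+r+M = trans (sym 1+M+r≡n) (cong suc (+-comm M r))
      θ₀ = completeSplit n≡1+r+M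
      θ★ = pinSplit θ₀ y₁
      module S = ColumnSplit θ★
      pinned : S.from (inj₁ fzero) ≡ y₁
      pinned = pinSplit-pinned θ₀ y₁
      tiles⊆E₁ : tiles a (toℕ x₁ + 1) ⊆ S.left E
      tiles⊆E₁ x j tile with pinSplit-left θ₀ y₁ complete (completeSplit-complete k≤M n≡1+r+M) j
      ... | inj₂ col-complete = complete⇒edge col-complete x
      ... | inj₁ col≡y₁ with E x (S.from (inj₁ j)) in Exc
      ...   | true  = refl
      ...   | false = contradiction (trans (sym tile₀) (first-tile-avoids {r} a x₁ a≤m')) λ ()
        where
        tile₀ : tiles {suc r} a (toℕ x₁ + 1) x₁ fzero ≡ true
        tile₀ = subst₂ (λ x′ j′ → tiles a (toℕ x₁ + 1) x′ j′ ≡ true)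
                       (in-row x (S.from (inj₁ j)) Exc) (inj₁-injective (S.from-injective (trans col≡y₁ (sym pinned)))) tile
      blocked<k : count (blocked (S.right E) id) < nonEdges E
      blocked<k = ≤-<-trans (count-blocked≤ (S.right E) id)
        (subst (nonEdges (S.right E) <_) (sym (S.nonEdges-split E))
               (m<n+m (nonEdges (S.right E)) (nonEdges>0 (S.left E) {x₁} {fzero} (trans (cong (E x₁) pinned) Ex₁y₁))))

-- Isomorphisms and edge counts

sum⊎ : ∀ {m n} → (Fin m ⊎ Fin n → ℕ) → ℕ
sum⊎ f = sumFin (λ x → f (inj₁ x)) + sumFin (λ y → f (inj₂ y))

sum⊎-cong : ∀ {m n} {f g : Fin m ⊎ Fin n → ℕ} → (∀ u → f u ≡ g u) → sum⊎ f ≡ sum⊎ g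
sum⊎-cong f≗g = cong₂ _+_ (sumFin-cong (λ x → f≗g (inj₁ x))) (sumFin-cong (λ y → f≗g (inj₂ y)))

sum⊎-↔ : ∀ {m n m′ n′} (σ : (Fin m ⊎ Fin n) ↔ (Fin m′ ⊎ Fin n′)) (f : Fin m′ ⊎ Fin n′ → ℕ) →
  sum⊎ (λ u → f (Inverse.to σ u)) ≡ sum⊎ f
sum⊎-↔ {m} σ f = trans (sym (sumFin-splitAt m (λ u → f (Inverse.to σ u)))) (sumFin-↔⊎ (σ ↔-∘ +↔⊎) f)

-- An isomorphism may exchange the sides, so edges are compared through degree sums over X ⊎ Y.
degreeSum : BipGraph → ℕ
degreeSum G = sum⊎ (λ u → sum⊎ (λ v → 𝟙 (adj G u v)))

degreeSum≡edges+edges : ∀ G → degreeSum G ≡ edges G + edges G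
degreeSum≡edges+edges (bip m n E) = begin
  sumFin (λ x → sumFin {m} (λ _ → 0) + sumFin (λ y → 𝟙 (E x y)))
    + sumFin (λ y → sumFin (λ x → 𝟙 (E x y)) + sumFin {n} (λ _ → 0))
    ≡⟨ cong₂ _+_ (sumFin-cong (λ x → cong (_+ sumFin (λ y → 𝟙 (E x y))) (sumFin-zero {m} (λ _ → refl))))
                 (sumFin-cong (λ y → trans (cong (sumFin (λ x → 𝟙 (E x y)) +_) (sumFin-zero {n} (λ _ → refl)))
                                           (+-identityʳ _))) ⟩
  sumFin (λ x → sumFin (λ y → 𝟙 (E x y))) + sumFin (λ y → sumFin (λ x → 𝟙 (E x y)))
    ≡⟨ cong (sumFin (λ x → sumFin (λ y → 𝟙 (E x y))) +_) (sumFin-comm (λ y x → 𝟙 (E x y))) ⟩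
  sumFin (λ x → sumFin (λ y → 𝟙 (E x y))) + sumFin (λ x → sumFin (λ y → 𝟙 (E x y)))
    ≡⟨ cong₂ _+_ (sumFin-cong (λ x → count≡sum𝟙 (E x))) (sumFin-cong (λ x → count≡sum𝟙 (E x))) ⟨
  edges (bip m n E) + edges (bip m n E) ∎
  where open ≡-Reasoning

≅⇒edges≡ : ∀ {G H} → G ≅ H → edges G ≡ edges H
≅⇒edges≡ {G} {H} (σ , preserves) = *-cancelˡ-≡ (edges G) (edges H) 2 (begin
  2 * edges G                  ≡⟨ cong (edges G +_) (+-identityʳ (edges G)) ⟩
  edges G + edges G            ≡⟨ degreeSum≡edges+edges G ⟨
  degreeSum G                  ≡⟨ sum⊎-cong (λ u → sum⊎-cong (λ v → cong 𝟙 (preserves u v))) ⟩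
  sum⊎ (λ u → sum⊎ (λ v → 𝟙 (adj H (to σ u) (to σ v))))
                               ≡⟨ sum⊎-cong (λ u → sum⊎-↔ σ (λ v → 𝟙 (adj H (to σ u) v))) ⟩
  sum⊎ (λ u → sum⊎ (λ v → 𝟙 (adj H (to σ u) v)))
                               ≡⟨ sum⊎-↔ σ (λ u → sum⊎ (λ v → 𝟙 (adj H u v))) ⟩
  degreeSum H                  ≡⟨ degreeSum≡edges+edges H ⟩
  edges H + edges H            ≡⟨ cong (edges H +_) (+-identityʳ (edges H)) ⟨
  2 * edges H                  ∎)
  where
  open ≡-Reasoning
  open Inverse using (to)

≅-trans : ∀ {G H L} → G ≅ H → H ≅ L → G ≅ L
≅-trans (σ , σ-preserves) (τ , τ-preserves) = τ ↔-∘ σ , λ u v → trans (σ-preserves u v) (τ-preserves _ _)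

transpose-≅ : ∀ {m n} (E : Fin m → Fin n → Bool) → bip m n E ≅ bip n m (λ y x → E x y)
transpose-≅ E = ⊎-comm _ _ , preserves
  where
  preserves : ∀ u v →
    adj (bip _ _ E) u v ≡ adj (bip _ _ (λ y x → E x y)) (Inverse.to (⊎-comm _ _) u) (Inverse.to (⊎-comm _ _) v)
  preserves (inj₁ x) (inj₁ _) = refl
  preserves (inj₁ x) (inj₂ y) = refl
  preserves (inj₂ y) (inj₁ x) = refl
  preserves (inj₂ y) (inj₂ _) = refl

column-star-≅ : ∀ {m n p q n′} (E : Fin m → Fin n → Bool) (y₁ : Fin n) → m ≡ p + q → n ≡ n′ + 1 →
  (∀ x y → E x y ≡ false → y ≡ y₁) → count (λ x → E x y₁) ≡ p → bip m n E ≅ D p q n′ 1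
column-star-≅ {p = p} {q} {n′} E y₁ refl refl in-column count≡p = σ , preserves
  where
  other : Fin (n′ + 1) → Bool
  other y = not (does (y ≟ᶠ y₁))
  count-other : count other ≡ n′
  count-other = +-cancelˡ-≡ 1 (count other) n′
    (trans (cong (_+ count other) (sym (count-≟ y₁))) (trans (count-compl (λ y → does (y ≟ᶠ y₁))) (+-comm n′ 1)))
  σ = sortPerm (λ x → E x y₁) ⊎-↔ sortPerm other
  star : ∀ x y → E x y ≡ E x y₁ ∨ other y
  star x y with y ≟ᶠ y₁
  ... | yes refl  = sym (∨-identityʳ (E x y₁))
  ... | no  y≢y₁ with E x y in Exy
  ...   | true  = sym (∨-zeroʳ (E x y₁))
  ...   | false = contradiction (in-column x y Exy) y≢y₁
  sorted : ∀ x y →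
    (toℕ (sortPerm (λ x → E x y₁) ⟨$⟩ʳ x) <ᵇ p) ∨ (toℕ (sortPerm other ⟨$⟩ʳ y) <ᵇ n′) ≡ E x y₁ ∨ other y
  sorted x y =
    cong₂ _∨_ (subst (λ c → (toℕ (sortPerm (λ x → E x y₁) ⟨$⟩ʳ x) <ᵇ c) ≡ E x y₁) count≡p (sortPerm-<ᵇ _ x))
                         (subst (λ c → (toℕ (sortPerm other ⟨$⟩ʳ y) <ᵇ c) ≡ other y) count-other (sortPerm-<ᵇ other y))
  preserves : ∀ u v → adj (bip _ _ E) u v ≡ adj (D p q n′ 1) (Inverse.to σ u) (Inverse.to σ v)
  preserves (inj₁ x) (inj₁ _) = refl
  preserves (inj₁ x) (inj₂ y) = trans (star x y) (sym (sorted x y))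
  preserves (inj₂ y) (inj₁ x) = trans (star x y) (sym (sorted x y))
  preserves (inj₂ y) (inj₂ _) = refl

edges-K : ∀ p q → edges (K p q) ≡ p * q
edges-K p q = trans (sumFin-cong {p} (λ _ → count-all-true {q} (λ _ → refl))) (sumFin-const {p} q)

edges-D : ∀ p q n′ → edges (D p q n′ 1) ≡ p + (p + q) * n′
edges-D p q n′ = begin
  edges (D p q n′ 1)                                                ≡⟨ sumFin-cong {p + q} (λ x → row (toℕ x <ᵇ p)) ⟩
  sumFin {p + q} (λ x → 𝟙 (toℕ x <ᵇ p) + n′)                        ≡⟨ sumFin-distrib-+ {p + q} (λ x → 𝟙 (toℕ x <ᵇ p)) (λ _ → n′) ⟩
  sumFin {p + q} (λ x → 𝟙 (toℕ x <ᵇ p)) + sumFin {p + q} (λ _ → n′)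
    ≡⟨ cong₂ _+_ (sym (count≡sum𝟙 {p + q} (λ x → toℕ x <ᵇ p))) (sumFin-const {p + q} n′) ⟩
  count {p + q} (λ x → toℕ x <ᵇ p) + (p + q) * n′                   ≡⟨ cong (_+ (p + q) * n′) (count-<ᵇ p (m≤m+n p q)) ⟩
  p + (p + q) * n′                                                  ∎
  where
  open ≡-Reasoning
  row : ∀ b → count {n′ + 1} (λ y → b ∨ (toℕ y <ᵇ n′)) ≡ 𝟙 b + n′
  row true  = trans (count-all-true (λ _ → refl)) (+-comm n′ 1)
  row false = count-<ᵇ n′ (m≤m+n n′ 1)

complete-bound : ∀ G → (edges G ≤ m G * n G) × ((edges G ≡ m G * n G) ⇔ (G ≅ K (m G) (n G)))
complete-bound (bip m n E) = ≤-trans (m≤m+n _ _) (≤-reflexive (edges+nonEdges m n E)) , mk⇔ to from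
  where
  G = bip m n E
  to : edges G ≡ m * n → G ≅ K m n
  to e≡mn = ↔-id _ , preserves
    where
    k≡0 : nonEdges E ≡ 0
    k≡0 = +-cancelˡ-≡ (edges G) (nonEdges E) 0 (trans (edges+nonEdges m n E) (trans (sym e≡mn) (sym (+-identityʳ _))))
    edge : ∀ x y → E x y ≡ true
    edge x y = not-injective (count≡0⇒false (λ y′ → not (E x y′))
                 (n≤0⇒n≡0 (≤-trans (≤-sumFin (λ x′ → count (λ y′ → not (E x′ y′))) x) (≤-reflexive k≡0))) y)
    preserves : ∀ u v → adj G u v ≡ adj (K m n) u v
    preserves (inj₁ x) (inj₁ _) = refl
    preserves (inj₁ x) (inj₂ y) = edge x y
    preserves (inj₂ y) (inj₁ x) = edge x y
    preserves (inj₂ y) (inj₂ _) = refl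
  from : G ≅ K m n → edges G ≡ m * n
  from G≅K = trans (≅⇒edges≡ G≅K) (edges-K m n)

-- The extremal graphs for part (iii)

Aligned : ∀ {m n} → (Fin m → Fin n → Bool) → Set
Aligned E = ∀ {x y x′ y′} → E x y ≡ false → E x′ y′ ≡ false → x ≡ x′ ⊎ y ≡ y′

aligned-nonEdges : ∀ {m n} (E : Fin m → Fin n → Bool) → Aligned E → ∀ {x₁ y₁} → E x₁ y₁ ≡ false →
  (∀ x y → E x y ≡ false → y ≡ y₁)
  ⊎ ((∀ x y → E x y ≡ false → x ≡ x₁) × Σ (Fin n) λ y₂ → y₂ ≢ y₁ × E x₁ y₂ ≡ false)
aligned-nonEdges E aligned {x₁} {y₁} E₁ with any? (λ x → any? (λ y → (E x y ≟ᴮ false) ×-dec ¬? (y ≟ᶠ y₁)))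
... | no  ¬off-column = inj₁ in-column
  where
  in-column : ∀ x y → E x y ≡ false → y ≡ y₁
  in-column x y Exy with y ≟ᶠ y₁
  ... | yes y≡y₁ = y≡y₁
  ... | no  y≢y₁ = contradiction (x , y , Exy , y≢y₁) ¬off-column
... | yes (x₂ , y₂ , E₂ , y₂≢y₁) = inj₂ (in-row , y₂ , y₂≢y₁ , subst (λ x → E x y₂ ≡ false) x₂≡x₁ E₂)
  where
  x₂≡x₁ : x₂ ≡ x₁
  x₂≡x₁ = Sum.[ (λ x₂≡x₁ → x₂≡x₁) , (λ y₂≡y₁ → contradiction y₂≡y₁ y₂≢y₁) ]′ (aligned E₂ E₁)
  in-row : ∀ x y → E x y ≡ false → x ≡ x₁
  in-row x y Exy with x ≟ᶠ x₁
  ... | yes x≡x₁ = x≡x₁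
  ... | no  x≢x₁ with aligned Exy E₁ | aligned Exy E₂
  ...   | inj₁ x≡x₁ | _          = contradiction x≡x₁ x≢x₁
  ...   | inj₂ _    | inj₁ x≡x₂  = contradiction (trans x≡x₂ x₂≡x₁) x≢x₁
  ...   | inj₂ y≡y₁ | inj₂ y≡y₂  = contradiction (trans (sym y≡y₂) y≡y₁) y₂≢y₁

module NestedExtremal {a′ b m′ n′ : ℕ} (E : Fin (suc m′) → Fin (suc n′) → Bool)
  (a≤b : suc a′ ≤ b) (M≤n : suc m′ ≤ suc n′) (an≤bM : suc a′ * suc n′ ≤ b * suc m′) (a≤M : suc a′ ≤ suc m′)
  (no-factor : ¬ HasFactor (suc a′) b (bip (suc m′) (suc n′) E)) where

  open Factors E M≤n

  M = suc m′
  G = bip M (suc n′) E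
  k = nonEdges E

  edges+k : edges G + k ≡ M + M * n′
  edges+k = trans (edges+nonEdges M (suc n′) E) (*-suc M n′)

  M≤k+a′ : M ≤ k + a′
  M≤k+a′ with k + suc a′ ≤? M
  ... | yes few  = contradiction (few-nonEdges-factor a≤b an≤bM few) no-factor
  ... | no  many = s≤s⁻¹ (≤-trans (≰⇒> many) (≤-reflexive (+-suc k a′)))

  edges-bound : edges G ≤ M * n′ + a′
  edges-bound = +-cancelʳ-≤ k (edges G) (M * n′ + a′) (begin
    edges G + k          ≡⟨ edges+k ⟩
    M + M * n′           ≤⟨ +-monoˡ-≤ (M * n′) M≤k+a′ ⟩
    k + a′ + M * n′      ≡⟨ solve 3 (λ k a x → k :+ a :+ x := x :+ a :+ k) refl k a′ (M * n′) ⟩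
    M * n′ + a′ + k      ∎)
    where
    open ≤-Reasoning

  M≡a′+q : M ≡ a′ + (m′ ∸ a′ + 1)
  M≡a′+q = sym (begin
    a′ + (m′ ∸ a′ + 1)   ≡⟨ cong (a′ +_) (+-comm (m′ ∸ a′) 1) ⟩
    a′ + suc (m′ ∸ a′)   ≡⟨ +-suc a′ (m′ ∸ a′) ⟩
    suc (a′ + (m′ ∸ a′)) ≡⟨ cong suc (m+[n∸m]≡n (s≤s⁻¹ a≤M)) ⟩
    M                    ∎)
    where open ≡-Reasoning

  ≅D⇒extremal : G ≅ D a′ (m′ ∸ a′ + 1) n′ 1 → edges G ≡ M * n′ + a′
  ≅D⇒extremal G≅D = begin
    edges G                                   ≡⟨ ≅⇒edges≡ G≅D ⟩
    edges (D a′ (m′ ∸ a′ + 1) n′ 1)           ≡⟨ edges-D a′ (m′ ∸ a′ + 1) n′ ⟩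
    a′ + (a′ + (m′ ∸ a′ + 1)) * n′            ≡⟨ cong (λ c → a′ + c * n′) M≡a′+q ⟨
    a′ + M * n′                               ≡⟨ +-comm a′ (M * n′) ⟩
    M * n′ + a′                               ∎
    where open ≡-Reasoning

  module Extremal (extremal : edges G ≡ M * n′ + a′) where

    k+a′≡M : k + a′ ≡ M
    k+a′≡M = +-cancelˡ-≡ (M * n′) (k + a′) M (begin
      M * n′ + (k + a′)   ≡⟨ solve 3 (λ x k a → x :+ (k :+ a) := x :+ a :+ k) refl (M * n′) k a′ ⟩
      M * n′ + a′ + k     ≡⟨ cong (_+ k) extremal ⟨
      edges G + k         ≡⟨ edges+k ⟩
      M + M * n′          ≡⟨ +-comm M (M * n′) ⟩
      M * n′ + M          ∎)
      where
      open ≡-Reasoning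

    k+a≡1+M : k + suc a′ ≡ suc M
    k+a≡1+M = trans (+-suc k a′) (cong suc k+a′≡M)

    aligned : Aligned E
    aligned {x} {y} {x′} {y′} Exy Ex′y′ with x ≟ᶠ x′ | y ≟ᶠ y′
    ... | yes x≡x′ | _        = inj₁ x≡x′
    ... | no  _    | yes y≡y′ = inj₂ y≡y′
    ... | no  x≢x′ | no  y≢y′ = contradiction (crossing-factor z<s a≤b an≤bM k+a≡1+M x≢x′ y≢y′ Exy Ex′y′) no-factor

    count+k≡ : ∀ {l} (f : Fin l → Bool) → k ≡ count (λ i → not (f i)) → count f + k ≡ l
    count+k≡ f k≡ = trans (cong (count f +_) k≡) (count-compl f)

    column-star : ∀ {y₁} → (∀ x y → E x y ≡ false → y ≡ y₁) → G ≅ D a′ (m′ ∸ a′ + 1) n′ 1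
    column-star {y₁} in-column = column-star-≅ E y₁ M≡a′+q (+-comm 1 n′) in-column
      (+-cancelʳ-≡ k _ a′ (trans (count+k≡ (λ x → E x y₁) (nonEdges-column E y₁ in-column))
                                (sym (trans (+-comm a′ k) k+a′≡M))))

    row-star : ∀ {x₁ y₁ y₂} → (∀ x y → E x y ≡ false → x ≡ x₁) → y₂ ≢ y₁ → E x₁ y₁ ≡ false → E x₁ y₂ ≡ false →
      G ≅ D a′ (m′ ∸ a′ + 1) n′ 1
    row-star {x₁} {y₁} {y₂} in-row y₂≢y₁ E₁ E₂ with M ≟ suc n′
    ... | yes M≡n = ≅-trans (transpose-≅ E)
      (column-star-≅ (λ y x → E x y) x₁ (trans (sym M≡n) M≡a′+q) (trans M≡n (+-comm 1 n′)) (λ y x Exy → in-row x y Exy) count-row)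
      where
      count-row : count (λ y → E x₁ y) ≡ a′
      count-row = +-cancelʳ-≡ k _ a′ (trans (count+k≡ (E x₁) (nonEdges-row E x₁ in-row))
                                            (sym (trans (+-comm a′ k) (trans k+a′≡M M≡n))))
    ... | no  M≢n = contradiction (row-star-factor z<s a≤b an≤bM k+a≡1+M (≤∧≢⇒< M≤n M≢n) a≤m′ E₁ in-row) no-factor
      where
      1<k : 1 < k
      1<k = subst (1 <_) (sym (nonEdges-row E x₁ in-row))
                  (count>1 (λ y → not (E x₁ y)) (y₂≢y₁ ∘ sym) (cong not E₁) (cong not E₂))
      a≤m′ : suc a′ ≤ m′
      a≤m′ = s≤s⁻¹ (subst (suc (suc a′) ≤_) k+a′≡M (+-monoˡ-≤ a′ 1<k))

    nonEdge⇒≅D : ∀ {x₁ y₁} → E x₁ y₁ ≡ false → G ≅ D a′ (m′ ∸ a′ + 1) n′ 1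
    nonEdge⇒≅D E₁ = Sum.[ column-star , (λ (in-row , _ , y₂≢y₁ , E₂) → row-star in-row y₂≢y₁ E₁ E₂) ]′
                          (aligned-nonEdges E aligned E₁)

    ≅D : G ≅ D a′ (m′ ∸ a′ + 1) n′ 1
    ≅D = nonEdge⇒≅D (proj₂ (proj₂ (nonEdge-witness E (+-cancelʳ-< a′ 0 k (subst (a′ <_) (sym k+a′≡M) a≤M)))))

nested-extremal : ∀ a b → 1 ≤ a → a ≤ b → (G : BipGraph) → m G ≤ n G → ¬ HasFactor a b G →
  a * n G ≤ b * m G → a ≤ m G →
  (edges G ≤ m G * (n G ∸ 1) + (a ∸ 1))
  × ((edges G ≡ m G * (n G ∸ 1) + (a ∸ 1)) ⇔ (G ≅ D (a ∸ 1) (m G ∸ a + 1) (n G ∸ 1) 1))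
nested-extremal (suc a′) b _ a≤b (bip (suc m′) (suc n′) E) M≤n no-factor an≤bM a≤M =
  edges-bound , mk⇔ Extremal.≅D ≅D⇒extremal
  where open NestedExtremal E a≤b M≤n an≤bM a≤M no-factor

theorem1p3 : (a b : ℕ) → 1 ≤ a → a ≤ b → (G : BipGraph) → m G ≤ n G → ¬ HasFactor a b G →
    ((b * m G < a * n G) →
        (edges G ≤ m G * n G) × ((edges G ≡ m G * n G) ⇔ (G ≅ K (m G) (n G))))
    × ((a * n G ≤ b * m G) → (m G < a) →
        (edges G ≤ m G * n G) × ((edges G ≡ m G * n G) ⇔ (G ≅ K (m G) (n G))))
    × ((a * n G ≤ b * m G) → (a ≤ m G) →
        (edges G ≤ m G * (n G ∸ 1) + (a ∸ 1))
        × ((edges G ≡ m G * (n G ∸ 1) + (a ∸ 1)) ⇔ (G ≅ D (a ∸ 1) (m G ∸ a + 1) (n G ∸ 1) 1)))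
theorem1p3 a b 1≤a a≤b G m≤n no-factor =
  (λ _ → complete-bound G) , (λ _ _ → complete-bound G) , nested-extremal a b 1≤a a≤b G m≤n no-factor
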